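{- Let $\preceq$ be an entrenchment relation. Then its weak maxiconsistent inference $\mathrel{|\!\sim^w_\preceq}$ is a nonmonotonic consequence relation.
   Context: $\mathcal{L}$ is the set of formulas of a propositional language closed under $\lor,\land,\neg,\to$. $\vdash\subseteq 2^{\mathcal{L}}\times\mathcal{L}$ is a fixed consequence relation including classical propositional logic, compact, satisfying the deduction theorem and disjunction in premises; $\alpha\vdash\beta$ means $\{\alpha\}\vdash\beta$; $\mathrm{Cn}(X)=\{\beta:X\vdash\beta\}$. An entrenchment relation is a binary relation $\preceq$ on $\mathcal{L}$ such that for all $\alpha,\beta,\gamma$: $\alpha\preceq\alpha$; $\alpha\vdash\beta$ and $\beta\preceq\gamma$ imply $\alpha\preceq\gamma$; if $\alpha\vdash\beta$ and $\beta\vdash\alpha$ then $\gamma\preceq\alpha$ iff $\gamma\preceq\beta$. $\mathrm{Coh}(\alpha)=\{\beta:\beta\not\preceq\neg\alpha\}$. Weak maxiconsistent inference: $U^\alpha=\{\alpha\to\beta:\beta\in U\}$; $\mathcal{B}^w(\alpha)$ = deductively closed $U$ ($U=\mathrm{Cn}(U)$) with $U^\alpha\subseteq\mathrm{Coh}(\alpha)$; $\mathcal{B}^w_{\max}(\alpha)$ = those $U\in\mathcal{B}^w(\alpha)$ such that no deductively closed $V\in\mathcal{B}^w(\alpha)$ has $U^\alpha\subsetneq V^\alpha$; $E^w(\alpha)=\bigcap\mathcal{B}^w_{\max}(\alpha)$ (empty intersection $=\mathcal{L}$); $\alpha\mathrel{|\!\sim^w_\preceq}\beta$ iff $\beta\in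 E^w(\alpha)$. A nonmonotonic consequence relation is a binary relation $\mathrel{|\!\sim}$ on $\mathcal{L}$ satisfying Supraclassicality ($\alpha\vdash\beta\Rightarrow\alpha\mathrel{|\!\sim}\beta$), Left Logical Equivalence ($\alpha\vdash\beta$, $\beta\vdash\alpha$, $\alpha\mathrel{|\!\sim}\gamma\Rightarrow\beta\mathrel{|\!\sim}\gamma$), Right Weakening ($\alpha\mathrel{|\!\sim}\beta$, $\beta\vdash\gamma\Rightarrow\alpha\mathrel{|\!\sim}\gamma$) and And ($\alpha\mathrel{|\!\sim}\beta$, $\alpha\mathrel{|\!\sim}\gamma\Rightarrow\alpha\mathrel{|\!\sim}\beta\land\gamma$). -}

module Defs where

open import Data.Bool using (Bool; true; false; _∧_; _∨_; not)
open import Data.List using (List)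
open import Data.List.Membership.Propositional using (_∈_)
open import Data.List.Relation.Unary.All using (All)
open import Data.Product using (_×_; ∃; Σ)
open import Data.Sum using (_⊎_)
open import Relation.Binary.PropositionalEquality using (_≡_)
open import Relation.Nullary using (¬_)

infixr 4 _⇒_
infixr 5 _⋁_
infixr 6 _⋀_
infix 7 ∼_
data Form (At : Set) : Set where
  atom : At → Form At
  _⋁_  : Form At → Form At → Form At
  _⋀_  : Form At → Form At → Form At
  ∼_   : Form At → Form At
  _⇒_  : Form At → Form At → Form At

eval : {At : Set} → (At → Bool) → Form At → Bool
eval v (atom p) = v p
eval v (φ ⋁ ψ) = eval v φ ∨ eval v ψ
eval v (φ ⋀ ψ) = eval v φ ∧ eval v ψ
eval v (∼ φ)   = not (eval v φ)
eval v (φ ⇒ ψ) = not (eval v φ) ∨ eval v ψ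

FSet : Set → Set₁
FSet At = Form At → Set

_∪_ : {At : Set} → FSet At → FSet At → FSet At
(X ∪ Y) γ = X γ ⊎ Y γ

｛_｝ : {At : Set} → Form At → FSet At
｛ α ｝ γ = γ ≡ α

_⊆_ : {At : Set} → FSet At → FSet At → Set
X ⊆ Y = ∀ γ → X γ → Y γ

listSet : {At : Set} → List (Form At) → FSet At
listSet Γ γ = γ ∈ Γ

record ConsequenceRelation (At : Set) : Set₁ where
  field
    _⊢_ : FSet At → Form At → Set
    reflexive   : ∀ X α → X α → X ⊢ α
    monotone    : ∀ X Y α → X ⊆ Y → X ⊢ α → Y ⊢ α
    cut         : ∀ X Y α → (∀ β → Y β → X ⊢ β) → (X ∪ Y) ⊢ α → X ⊢ α
    classical   : ∀ X (Γ : List (Form At)) φ → All X Γ →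
                  (∀ v → All (λ ψ → eval v ψ ≡ true) Γ → eval v φ ≡ true) →
                  X ⊢ φ
    compact     : ∀ X α → X ⊢ α → ∃ λ (Γ : List (Form At)) → All X Γ × (listSet Γ ⊢ α)
    deduction   : ∀ X α β → (X ∪ ｛ α ｝) ⊢ β → X ⊢ (α ⇒ β)
    deduction⁻¹ : ∀ X α β → X ⊢ (α ⇒ β) → (X ∪ ｛ α ｝) ⊢ β
    disjPrem    : ∀ X α β γ → (X ∪ ｛ α ｝) ⊢ γ → (X ∪ ｛ β ｝) ⊢ γ →
                  (X ∪ ｛ α ⋁ β ｝) ⊢ γ

module _ {At : Set} (CR : ConsequenceRelation At) where
  open ConsequenceRelation CR

  _⊢₁_ : Form At → Form At → Set
  α ⊢₁ β = ｛ α ｝ ⊢ β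

  record IsEntrenchment (_⪯_ : Form At → Form At → Set) : Set where
    field
      ⪯-refl  : ∀ α → α ⪯ α
      ⪯-⊢     : ∀ α β γ → α ⊢₁ β → β ⪯ γ → α ⪯ γ
      ⪯-equiv : ∀ α β γ → α ⊢₁ β → β ⊢₁ α → (γ ⪯ α → γ ⪯ β) × (γ ⪯ β → γ ⪯ α)

  record IsNonmonotonicCR (_|~_ : Form At → Form At → Set) : Set where
    field
      supraclassicality : ∀ α β → α ⊢₁ β → α |~ β
      leftLogEquiv      : ∀ α β γ → α ⊢₁ β → β ⊢₁ α → α |~ γ → β |~ γ
      rightWeakening    : ∀ α β γ → α |~ β → β ⊢₁ γ → α |~ γ
      and               : ∀ α β γ → α |~ β → α |~ γ → α |~ (β ⋀ γ)

  module Weak (_⪯_ : Form At → Form At → Set) where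
    BSet : Set
    BSet = Form At → Bool

    mem : BSet → FSet At
    mem U β = U β ≡ true

    img : BSet → Form At → FSet At
    img U α γ = Σ (Form At) λ β → mem U β × (γ ≡ (α ⇒ β))

    Coh : Form At → FSet At
    Coh α β = ¬ (β ⪯ (∼ α))

    Closed : BSet → Set
    Closed U = (mem U ⊆ (λ β → mem U ⊢ β)) × ((λ β → mem U ⊢ β) ⊆ mem U)

    Bw : Form At → BSet → Set
    Bw α U = Closed U × (img U α ⊆ Coh α)

    _⊊_ : FSet At → FSet At → Set
    A ⊊ B = (A ⊆ B) × ¬ (B ⊆ A)

    Bmax : Form At → BSet → Set
    Bmax α U = Bw α U × (∀ V → Bw α V → ¬ (img U α ⊊ img V α))

    Ew : Form At → FSet At
    Ew α β = ∀ U → Bmax α U → mem U β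

    _|~w_ : Form At → Form At → Set
    α |~w β = Ew α β

{-# OPTIONS --safe #-}
-- Right Weakening and And hold because E^w(α) is an intersection of
-- deductively closed sets.  For interderivable α and β the formulas ¬α, ¬β
-- are equally entrenched and α → δ, β → δ are interderivable, so
-- B^w(α) = B^w(β); moreover U^α ⊊ V^α iff U ⊊ V, whatever α is, so the
-- maximal elements agree as well.  For Supraclassicality, take U maximal in
-- B^w(α): its residual {δ : α → δ ∈ U} is again in B^w(α), because
-- α → (α → δ) ⊢ α → δ and Coh(α) is closed upwards under ⊢; it contains U,
-- so by maximality it equals U, and it contains every consequence of α.
module Submission where

open import Defs
open import Data.Bool using (true; false)
open import Data.Bool.Properties using (_≟_)
open import Data.List using (List; []; _∷_)
open import Data.List.Relation.Unary.All using (All; []; _∷_; lookup; tabulate)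
open import Data.Product using (_,_; proj₁; proj₂)
open import Data.Sum using (inj₁; inj₂)
open import Function using (id)
open import Relation.Binary.PropositionalEquality using (_≡_; refl)
open import Relation.Nullary using (¬_)
open import Relation.Nullary.Decidable using (decidable-stable)

module _ {At : Set} where

  infix 2 _⊨_
  _⊨_ : List (Form At) → Form At → Set
  Γ ⊨ φ = ∀ v → All (λ ψ → eval v ψ ≡ true) Γ → eval v φ ≡ true

  mp-⊨ : ∀ {α β} → (α ⇒ β) ∷ α ∷ [] ⊨ β
  mp-⊨ {α} v (p ∷ q ∷ []) with eval v α
  mp-⊨ v (p ∷ q ∷ []) | true = p

  efq-⊨ : ∀ {α β} → α ∷ ∼ α ∷ [] ⊨ β
  efq-⊨ {α} v (p ∷ q ∷ []) with eval v α
  efq-⊨ v (p ∷ () ∷ []) | true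

  ⇒-self-refuting-⊨ : ∀ {α} → (α ⇒ ∼ α) ∷ [] ⊨ ∼ α
  ⇒-self-refuting-⊨ {α} v (p ∷ []) with eval v α
  ... | true  = p
  ... | false = refl

  ⇒-weaken-⊨ : ∀ {α β} → β ∷ [] ⊨ α ⇒ β
  ⇒-weaken-⊨ {α} v (p ∷ []) with eval v α
  ... | true  = p
  ... | false = refl

  ⇒-contract-⊨ : ∀ {α β} → (α ⇒ (α ⇒ β)) ∷ [] ⊨ α ⇒ β
  ⇒-contract-⊨ {α} v (p ∷ []) with eval v α
  ... | true  = p
  ... | false = refl

  ⋀-intro-⊨ : ∀ {α β} → α ∷ β ∷ [] ⊨ α ⋀ β
  ⋀-intro-⊨ {α} {β} v (p ∷ q ∷ []) with eval v α | eval v β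
  ⋀-intro-⊨ v (refl ∷ refl ∷ []) | true | true = refl

module Derivations {At : Set} (CR : ConsequenceRelation At) where
  open ConsequenceRelation CR

  ⊢-trans : ∀ {X Y φ} → (∀ ψ → Y ψ → X ⊢ ψ) → Y ⊢ φ → X ⊢ φ
  ⊢-trans {X} {Y} {φ} X⊢Y Y⊢φ = cut X Y φ X⊢Y (monotone Y (X ∪ Y) φ (λ _ → inj₂) Y⊢φ)

  ⊢-by-⊨ : ∀ {X Γ φ} → All (X ⊢_) Γ → Γ ⊨ φ → X ⊢ φ
  ⊢-by-⊨ {Γ = Γ} {φ} X⊢Γ Γ⊨φ =
    ⊢-trans (λ _ → lookup X⊢Γ) (classical (listSet Γ) Γ φ (tabulate id) Γ⊨φ)

  ⊢-⊢₁ : ∀ {X α β} → X ⊢ α → ｛ α ｝ ⊢ β → X ⊢ β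
  ⊢-⊢₁ X⊢α α⊢β = ⊢-trans (λ { _ refl → X⊢α }) α⊢β

  assumption : ∀ {X φ} → X φ → X ⊢ φ
  assumption {X} {φ} = reflexive X φ

  contraposition : ∀ {α β} → ｛ α ｝ ⊢ β → ｛ ∼ β ｝ ⊢ (∼ α)
  contraposition {α} {β} α⊢β =
    ⊢-by-⊨ (deduction ｛ ∼ β ｝ α (∼ α) α-refutes-itself ∷ []) ⇒-self-refuting-⊨
    where
    α-refutes-itself : (｛ ∼ β ｝ ∪ ｛ α ｝) ⊢ (∼ α)
    α-refutes-itself =
      ⊢-by-⊨ (⊢-⊢₁ (assumption (inj₂ refl)) α⊢β ∷ assumption (inj₁ refl) ∷ []) (efq-⊨ {β = ∼ α})

  ⇒-antitoneˡ : ∀ {α β δ} → ｛ α ｝ ⊢ β → ｛ β ⇒ δ ｝ ⊢ (α ⇒ δ)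
  ⇒-antitoneˡ {α} {β} {δ} α⊢β = deduction ｛ β ⇒ δ ｝ α δ
    (⊢-by-⊨ (assumption (inj₁ refl) ∷ ⊢-⊢₁ (assumption (inj₂ refl)) α⊢β ∷ []) mp-⊨)

module WeakInference {At : Set} (CR : ConsequenceRelation At)
  (_⪯_ : Form At → Form At → Set) where
  open ConsequenceRelation CR
  open Derivations CR
  open Weak CR _⪯_

  closed-⊢ : ∀ {U β} → Closed U → mem U ⊢ β → mem U β
  closed-⊢ {β = β} U-closed = proj₂ U-closed β

  Ew-⊢₁ : ∀ {α β γ} → Ew α β → ｛ β ｝ ⊢ γ → Ew α γ
  Ew-⊢₁ α|~β β⊢γ U U-max =
    closed-⊢ (proj₁ (proj₁ U-max)) (⊢-⊢₁ (assumption (α|~β U U-max)) β⊢γ)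

  Ew-⋀ : ∀ {α β γ} → Ew α β → Ew α γ → Ew α (β ⋀ γ)
  Ew-⋀ α|~β α|~γ U U-max = closed-⊢ (proj₁ (proj₁ U-max))
    (⊢-by-⊨ (assumption (α|~β U U-max) ∷ assumption (α|~γ U U-max) ∷ []) ⋀-intro-⊨)

  img-⊆ : ∀ {U V α} → img U α ⊆ img V α → mem U ⊆ mem V
  img-⊆ {α = α} Uα⊆Vα δ δ∈U with Uα⊆Vα (α ⇒ δ) (δ , δ∈U , refl)
  ... | _ , δ∈V , refl = δ∈V

  ⊆-img : ∀ {U V α} → mem U ⊆ mem V → img U α ⊆ img V α
  ⊆-img U⊆V _ (δ , δ∈U , refl) = δ , U⊆V δ δ∈U , refl

  img-⊊-transfer : ∀ {U V α β} → img U α ⊊ img V α → img U β ⊊ img V β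
  img-⊊-transfer {U} {V} {α} (Uα⊆Vα , Vα⊈Uα) =
    ⊆-img (img-⊆ Uα⊆Vα) , λ Vβ⊆Uβ → Vα⊈Uα (⊆-img {V} {U} {α} (img-⊆ Vβ⊆Uβ))

  residual : BSet → Form At → BSet
  residual U α δ = U (α ⇒ δ)

  residual-closed : ∀ {U α} → Closed U → Closed (residual U α)
  residual-closed {U} {α} U-closed = (λ _ → assumption) , λ γ residual⊢γ →
    closed-⊢ U-closed (deduction (mem U) α γ (⊢-trans
      (λ δ αδ∈U → deduction⁻¹ (mem U) α δ (assumption αδ∈U)) residual⊢γ))

  ⊆-residual : ∀ {U α} → Closed U → mem U ⊆ mem (residual U α)
  ⊆-residual {α = α} U-closed δ δ∈U =
    closed-⊢ U-closed (⊢-by-⊨ (assumption δ∈U ∷ []) (⇒-weaken-⊨ {α = α}))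

  ⊢-residual : ∀ {U α β} → Closed U → ｛ α ｝ ⊢ β → mem (residual U α) β
  ⊢-residual {U} {α} {β} U-closed α⊢β = closed-⊢ U-closed
    (deduction (mem U) α β (monotone ｛ α ｝ (mem U ∪ ｛ α ｝) β (λ _ → inj₂) α⊢β))

  module _ (E : IsEntrenchment CR _⪯_) where
    open IsEntrenchment E

    Coh-upward : ∀ {α β γ} → ｛ β ｝ ⊢ γ → Coh α β → Coh α γ
    Coh-upward {α} {β} {γ} β⊢γ β-coh γ⪯∼α = β-coh (⪯-⊢ β γ (∼ α) β⊢γ γ⪯∼α)

    Coh-resp : ∀ {α β γ} → ｛ α ｝ ⊢ β → ｛ β ｝ ⊢ α → Coh β γ → Coh α γ
    Coh-resp {α} {β} {γ} α⊢β β⊢α γ-coh γ⪯∼α = γ-coh (proj₁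
      (⪯-equiv (∼ α) (∼ β) γ (contraposition β⊢α) (contraposition α⊢β)) γ⪯∼α)

    Bw-resp : ∀ {α β U} → ｛ α ｝ ⊢ β → ｛ β ｝ ⊢ α → Bw β U → Bw α U
    Bw-resp {β = β} α⊢β β⊢α (U-closed , Uβ-coh) = U-closed , λ { _ (δ , δ∈U , refl) →
      Coh-resp α⊢β β⊢α (Coh-upward (⇒-antitoneˡ α⊢β) (Uβ-coh (β ⇒ δ) (δ , δ∈U , refl))) }

    Bmax-resp : ∀ {α β U} → ｛ α ｝ ⊢ β → ｛ β ｝ ⊢ α → Bmax β U → Bmax α U
    Bmax-resp α⊢β β⊢α (U-bw , U-max) = Bw-resp α⊢β β⊢α U-bw , λ V V-bw Uα⊊Vα →
      U-max V (Bw-resp β⊢α α⊢β V-bw) (img-⊊-transfer Uα⊊Vα)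

    Ew-resp : ∀ {α β γ} → ｛ α ｝ ⊢ β → ｛ β ｝ ⊢ α → Ew α γ → Ew β γ
    Ew-resp α⊢β β⊢α α|~γ U U-max = α|~γ U (Bmax-resp α⊢β β⊢α U-max)

    residual-Bw : ∀ {α U} → Bw α U → Bw α (residual U α)
    residual-Bw {α} (U-closed , Uα-coh) = residual-closed U-closed ,
      λ { _ (δ , αδ∈U , refl) → Coh-upward (⊢-by-⊨ (assumption refl ∷ []) ⇒-contract-⊨)
            (Uα-coh (α ⇒ (α ⇒ δ)) ((α ⇒ δ) , αδ∈U , refl)) }

    Bmax-¬¬-⊇ : ∀ {α U V} → Bmax α U → Bw α V → mem U ⊆ mem V → ¬ ¬ (mem V ⊆ mem U)
    Bmax-¬¬-⊇ (_ , U-max) V-bw U⊆V V⊈U =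
      U-max _ V-bw (⊆-img U⊆V , λ Vα⊆Uα → V⊈U (img-⊆ Vα⊆Uα))

    Bmax-⊢ : ∀ {α β U} → Bmax α U → ｛ α ｝ ⊢ β → mem U β
    Bmax-⊢ {β = β} {U} U-max@((U-closed , _) , _) α⊢β =
      -- maximality only yields ¬ ¬ (β ∈ U); Bool-valued membership removes the ¬ ¬
      decidable-stable (U β ≟ true) λ β∉U →
        Bmax-¬¬-⊇ U-max (residual-Bw (proj₁ U-max)) (⊆-residual U-closed)
          (λ residual⊆U → β∉U (residual⊆U β (⊢-residual U-closed α⊢β)))

mainTheorem15 : {At : Set} (CR : ConsequenceRelation At)
                (_⪯_ : Form At → Form At → Set) →
                IsEntrenchment CR _⪯_ →
                IsNonmonotonicCR CR (Weak._|~w_ CR _⪯_)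
mainTheorem15 CR _⪯_ E = record
  { supraclassicality = λ _ _ α⊢β U U-max → Bmax-⊢ E U-max α⊢β
  ; leftLogEquiv      = λ _ _ _ → Ew-resp E
  ; rightWeakening    = λ _ _ _ → Ew-⊢₁
  ; and               = λ _ _ _ → Ew-⋀
  }
  where open WeakInference CR _⪯_
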